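{- Let $G=(V,E)$ be a graph, $k\ge 1$, $v\in V$, and let $X$ be a feasible solution with $v\notin X$. If $N(v)$ contains a clique of size $k+2$, then $v$ lies in a clique component of $G-X$. If $N(v)$ contains an independent set of size $k+2$, then $v$ lies in a tree component of $G-X$.
   Context: Graphs are undirected, without self-loops, possibly with multi-edges. $N(v)$ is the set of neighbors of $v$. A set induces a clique if there is exactly one edge between any two distinct vertices, an independent set if there is no edge between any two of its vertices, and a tree if connected with no cycle. A feasible solution for $(G,k)$ is a set $X\subseteq V$ with $|X|\le k$ such that every connected component of $G-X$ is a clique or a tree; a clique (tree) component is a component of $G-X$ that is a clique (tree). -}

module Defs where

open import Data.Nat using (ℕ; zero; suc; _≤_; _+_)
open import Data.Fin using (Fin; zero; suc; inject₁; fromℕ)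
open import Data.Fin.Subset using (Subset; _∈_; _∉_; ∣_∣)
open import Data.Product using (Σ; ∃; _×_; _,_; proj₁; proj₂)
open import Data.Sum using (_⊎_)
open import Data.Empty using (⊥)
open import Relation.Nullary using (¬_)
open import Relation.Binary.PropositionalEquality using (_≡_; _≢_)
open import Relation.Binary.Construct.Closure.ReflexiveTransitive using (Star)
open import Function.Definitions using (Injective)

-- A finite multigraph without self-loops: vertices Fin n, edges Fin m,
-- each edge has two (distinct) endpoints.
record Graph : Set where
  field
    n      : ℕ
    m      : ℕ
    ends   : Fin m → Fin n × Fin n
    noLoop : ∀ e → proj₁ (ends e) ≢ proj₂ (ends e)

module _ (G : Graph) where
  open Graph G

  Vertex : Set
  Vertex = Fin n

  Joins : Fin m → Fin n → Fin n → Set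
  Joins e u w = (ends e ≡ (u , w)) ⊎ (ends e ≡ (w , u))

  InN : Fin n → Fin n → Set
  InN v w = ∃ λ e → Joins e v w

  ExactlyOneEdge : Fin n → Fin n → Set
  ExactlyOneEdge u w = (∃ λ e → Joins e u w) × (∀ e e′ → Joins e u w → Joins e′ u w → e ≡ e′)

  IsCliqueP : (Fin n → Set) → Set
  IsCliqueP S = ∀ u w → S u → S w → u ≢ w → ExactlyOneEdge u w

  IsIndepP : (Fin n → Set) → Set
  IsIndepP S = ∀ u w → S u → S w → ∀ e → ¬ Joins e u w

  AdjIn : (Fin n → Set) → Fin n → Fin n → Set
  AdjIn S u w = S u × S w × (∃ λ e → Joins e u w)

  -- a cycle in the subgraph induced by S: closed walk v₀ e₀ v₁ … e_{l-1} v_l = v₀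
  -- of length l ≥ 2, with pairwise distinct vertices v₀ … v_{l-1} and pairwise
  -- distinct edges (length 2 cycles arise from parallel edges)
  record CycleIn (S : Fin n → Set) : Set where
    field
      len     : ℕ
      len≥2   : 2 ≤ len
      vs      : Fin (suc len) → Fin n
      es      : Fin len → Fin m
      closed  : vs (fromℕ len) ≡ vs zero
      inS     : ∀ i → S (vs i)
      vsInj   : Injective _≡_ _≡_ (λ (i : Fin len) → vs (inject₁ i))
      esInj   : Injective _≡_ _≡_ es
      joins   : ∀ i → Joins (es i) (vs (inject₁ i)) (vs (suc i))

  IsTreeP : (Fin n → Set) → Set
  IsTreeP S = (∀ u w → S u → S w → Star (AdjIn S) u w) × ¬ CycleIn S

  Outside : Subset n → Fin n → Set
  Outside X u = u ∉ X

  Component : Subset n → Fin n → Fin n → Set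
  Component X v u = Star (AdjIn (Outside X)) v u

  CliqueComponent : Subset n → Fin n → Set
  CliqueComponent X v = IsCliqueP (Component X v)

  TreeComponent : Subset n → Fin n → Set
  TreeComponent X v = IsTreeP (Component X v)

  Feasible : ℕ → Subset n → Set
  Feasible k X = (∣ X ∣ ≤ k) × (∀ v → v ∉ X → CliqueComponent X v ⊎ TreeComponent X v)

  NbhdHasClique : Fin n → ℕ → Set
  NbhdHasClique v s = Σ (Subset n) λ K → (∣ K ∣ ≡ s) × (∀ u → u ∈ K → InN v u) × IsCliqueP (λ u → u ∈ K)

  NbhdHasIndep : Fin n → ℕ → Set
  NbhdHasIndep v s = Σ (Subset n) λ K → (∣ K ∣ ≡ s) × (∀ u → u ∈ K → InN v u) × IsIndepP (λ u → u ∈ K)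

{-# OPTIONS --safe #-}
-- At most k of the k + 2 neighbours of v lie in X, so two of them, a and b, survive in the
-- component of v.  If they are adjacent, v a b is a triangle and the component is no tree;
-- if they are not, the component is no clique.
module Submission where

open import Defs
open import Data.Nat using (ℕ; _≤_; _+_; _<_; z≤n; s≤s)
open import Data.Fin.Subset using (Subset; _∉_; _∈_; ∣_∣; _∪_; ⁅_⁆; inside; outside)
open import Data.Product using (_×_; ∃; ∃₂; _,_; proj₁; proj₂)
open import Data.Nat.Properties
  using (≤-trans; ≤-reflexive; n≤1+n; ≤-<-trans; +-suc; +-comm; +-monoʳ-≤; module ≤-Reasoning)
open import Data.Fin using (Fin; zero; suc; inject₁)
open import Data.Fin.Subset.Properties using (drop-there; ∣p∣≤∣x∷p∣; ∣⁅x⁆∣≡1; x∈⁅x⁆; x∈p∪q⁺)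
open import Data.Vec using (_∷_; []; here; there)
open import Data.Sum using (inj₁; inj₂)
open import Data.Empty using (⊥-elim)
open import Relation.Nullary using (¬_)
open import Function using (_∘_)
open import Function.Definitions using (Injective)
open import Relation.Binary.PropositionalEquality using (_≡_; _≢_; refl; sym; trans; cong)
open import Relation.Binary.Construct.Closure.ReflexiveTransitive using (ε; _◅_)

∃∈∧∉-there : ∀ {n s t} {p q : Subset n} →
             (∃ λ x → x ∈ p × x ∉ q) → ∃ λ x → x ∈ s ∷ p × x ∉ t ∷ q
∃∈∧∉-there (x , x∈p , x∉q) = suc x , there x∈p , x∉q ∘ drop-there

∣p∪q∣≤∣p∣+∣q∣ : ∀ {n} (p q : Subset n) → ∣ p ∪ q ∣ ≤ ∣ p ∣ + ∣ q ∣
∣p∪q∣≤∣p∣+∣q∣ []            []           = z≤n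
∣p∪q∣≤∣p∣+∣q∣ (inside ∷ p)  (x ∷ q)      =
  s≤s (≤-trans (∣p∪q∣≤∣p∣+∣q∣ p q) (+-monoʳ-≤ ∣ p ∣ (∣p∣≤∣x∷p∣ x q)))
∣p∪q∣≤∣p∣+∣q∣ (outside ∷ p) (inside ∷ q)  =
  ≤-trans (s≤s (∣p∪q∣≤∣p∣+∣q∣ p q)) (≤-reflexive (sym (+-suc ∣ p ∣ ∣ q ∣)))
∣p∪q∣≤∣p∣+∣q∣ (outside ∷ p) (outside ∷ q) = ∣p∪q∣≤∣p∣+∣q∣ p q

∣q∣<∣p∣⇒∃∈p∧∉q : ∀ {n} (p q : Subset n) → ∣ q ∣ < ∣ p ∣ → ∃ λ x → x ∈ p × x ∉ q
∣q∣<∣p∣⇒∃∈p∧∉q []            []            ()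
∣q∣<∣p∣⇒∃∈p∧∉q (inside ∷ p)  (outside ∷ q) _         = zero , here , λ ()
∣q∣<∣p∣⇒∃∈p∧∉q (inside ∷ p)  (inside ∷ q)  (s≤s q<p) = ∃∈∧∉-there (∣q∣<∣p∣⇒∃∈p∧∉q p q q<p)
∣q∣<∣p∣⇒∃∈p∧∉q (outside ∷ p) (x ∷ q)       q<p       =
  ∃∈∧∉-there (∣q∣<∣p∣⇒∃∈p∧∉q p q (≤-<-trans (∣p∣≤∣x∷p∣ x q) q<p))

two-∈p∧∉q : ∀ {n} (p q : Subset n) → 2 + ∣ q ∣ ≤ ∣ p ∣ →
            ∃₂ λ a b → a ≢ b × (a ∈ p × a ∉ q) × (b ∈ p × b ∉ q)
two-∈p∧∉q p q 2+q≤p with ∣q∣<∣p∣⇒∃∈p∧∉q p q (≤-trans (n≤1+n _) 2+q≤p)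
... | a , a∈p , a∉q with ∣q∣<∣p∣⇒∃∈p∧∉q p (q ∪ ⁅ a ⁆) ∣q∪a∣<∣p∣
  where
  open ≤-Reasoning
  ∣q∪a∣<∣p∣ : ∣ q ∪ ⁅ a ⁆ ∣ < ∣ p ∣
  ∣q∪a∣<∣p∣ = begin-strict
    ∣ q ∪ ⁅ a ⁆ ∣        ≤⟨ ∣p∪q∣≤∣p∣+∣q∣ q ⁅ a ⁆ ⟩
    ∣ q ∣ + ∣ ⁅ a ⁆ ∣    ≡⟨ cong (∣ q ∣ +_) (∣⁅x⁆∣≡1 a) ⟩
    ∣ q ∣ + 1            ≡⟨ +-comm ∣ q ∣ 1 ⟩
    1 + ∣ q ∣            <⟨ 2+q≤p ⟩
    ∣ p ∣                ∎
... | b , b∈p , b∉q∪a =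
  a , b , (λ { refl → b∉q∪a (x∈p∪q⁺ (inj₂ (x∈⁅x⁆ a))) }) , (a∈p , a∉q) , (b∈p , b∉q∪a ∘ x∈p∪q⁺ ∘ inj₁)

injective-Fin3 : ∀ {a} {A : Set a} (f : Fin 3 → A) →
                 f zero ≢ f (suc zero) → f zero ≢ f (suc (suc zero)) →
                 f (suc zero) ≢ f (suc (suc zero)) → Injective _≡_ _≡_ f
injective-Fin3 f f₀≢f₁ f₀≢f₂ f₁≢f₂ = go _ _
  where
  go : ∀ i j → f i ≡ f j → i ≡ j
  go zero                zero                _ = refl
  go zero                (suc zero)          p = ⊥-elim (f₀≢f₁ p)
  go zero                (suc (suc zero))    p = ⊥-elim (f₀≢f₂ p)
  go (suc zero)          zero                p = ⊥-elim (f₀≢f₁ (sym p))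
  go (suc zero)          (suc zero)          _ = refl
  go (suc zero)          (suc (suc zero))    p = ⊥-elim (f₁≢f₂ p)
  go (suc (suc zero))    zero                p = ⊥-elim (f₀≢f₂ (sym p))
  go (suc (suc zero))    (suc zero)          p = ⊥-elim (f₁≢f₂ (sym p))
  go (suc (suc zero))    (suc (suc zero))    _ = refl

module _ (G : Graph) where
  open Graph G

  Joins-sym : ∀ {e u w} → Joins G e u w → Joins G e w u
  Joins-sym (inj₁ p) = inj₂ p
  Joins-sym (inj₂ p) = inj₁ p

  Joins⇒≢ : ∀ {e u w} → Joins G e u w → u ≢ w
  Joins⇒≢ {e} (inj₁ p) refl = noLoop e (trans (cong proj₁ p) (sym (cong proj₂ p)))
  Joins⇒≢ {e} (inj₂ p) refl = noLoop e (trans (cong proj₁ p) (sym (cong proj₂ p)))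

  Joins-consecutive : ∀ {e u w x} → Joins G e u w → Joins G e w x → u ≡ x
  Joins-consecutive (inj₁ p) (inj₁ q) = ⊥-elim (Joins⇒≢ (inj₁ p) (cong proj₁ (trans (sym p) q)))
  Joins-consecutive (inj₁ p) (inj₂ q) = cong proj₁ (trans (sym p) q)
  Joins-consecutive (inj₂ p) (inj₁ q) = cong proj₂ (trans (sym p) q)
  Joins-consecutive (inj₂ p) (inj₂ q) = ⊥-elim (Joins⇒≢ (inj₂ p) (cong proj₂ (trans (sym p) q)))

  triangle⇒CycleIn : ∀ {S : Vertex G → Set} {u w x e₁ e₂ e₃} → S u → S w → S x →
                     Joins G e₁ u w → Joins G e₂ w x → Joins G e₃ x u → CycleIn G S
  triangle⇒CycleIn {S} {u} {w} {x} {e₁} {e₂} {e₃} Su Sw Sx j₁ j₂ j₃ = record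
    { len    = 3
    ; len≥2  = s≤s (s≤s z≤n)
    ; vs     = vs
    ; es     = es
    ; closed = refl
    ; inS    = inS
    ; vsInj  = injective-Fin3 _ (Joins⇒≢ j₁) (Joins⇒≢ j₃ ∘ sym) (Joins⇒≢ j₂)
    ; esInj  = injective-Fin3 es
                 (λ { refl → Joins⇒≢ j₃ (sym (Joins-consecutive j₁ j₂)) })
                 (λ { refl → Joins⇒≢ j₂ (sym (Joins-consecutive j₃ j₁)) })
                 (λ { refl → Joins⇒≢ j₁ (sym (Joins-consecutive j₂ j₃)) })
    ; joins  = joins
    }
    where
    vs : Fin 4 → Vertex G
    vs zero                   = u
    vs (suc zero)             = w
    vs (suc (suc zero))       = x
    vs (suc (suc (suc zero))) = u
    es : Fin 3 → Fin m
    es zero             = e₁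
    es (suc zero)       = e₂
    es (suc (suc zero)) = e₃
    inS : ∀ i → S (vs i)
    inS zero                   = Su
    inS (suc zero)             = Sw
    inS (suc (suc zero))       = Sx
    inS (suc (suc (suc zero))) = Su
    joins : ∀ i → Joins G (es i) (vs (inject₁ i)) (vs (suc i))
    joins zero             = j₁
    joins (suc zero)       = j₂
    joins (suc (suc zero)) = j₃

  neighbour∈Component : ∀ {X v u e} → v ∉ X → u ∉ X → Joins G e v u → Component G X v u
  neighbour∈Component v∉X u∉X j = (v∉X , u∉X , _ , j) ◅ ε

  adjacent-neighbours⇒¬TreeComponent : ∀ {X v a b} → v ∉ X → a ∉ X → b ∉ X →
                                       InN G v a → InN G v b → (∃ λ e → Joins G e a b) →
                                       ¬ TreeComponent G X v
  adjacent-neighbours⇒¬TreeComponent v∉X a∉X b∉X (_ , va) (_ , vb) (_ , ab) (_ , acyclic) =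
    acyclic (triangle⇒CycleIn ε (neighbour∈Component v∉X a∉X va)
                                (neighbour∈Component v∉X b∉X vb) va ab (Joins-sym vb))

  nonadjacent-neighbours⇒¬CliqueComponent : ∀ {X v a b} → v ∉ X → a ∉ X → b ∉ X → a ≢ b →
                                            InN G v a → InN G v b → (∀ e → ¬ Joins G e a b) →
                                            ¬ CliqueComponent G X v
  nonadjacent-neighbours⇒¬CliqueComponent {a = a} {b} v∉X a∉X b∉X a≢b (_ , va) (_ , vb) ¬ab clique =
    let (e , ab) = proj₁ (clique a b (neighbour∈Component v∉X a∉X va)
                                     (neighbour∈Component v∉X b∉X vb) a≢b)
    in ¬ab e ab

lemma7 : (G : Graph) (k : ℕ) → 1 ≤ k → (v : Vertex G) → (X : Subset (Graph.n G)) →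
           Feasible G k X → v ∉ X →
           (NbhdHasClique G v (k + 2) → CliqueComponent G X v) ×
           (NbhdHasIndep G v (k + 2) → TreeComponent G X v)
lemma7 G k _ v X (∣X∣≤k , feasible) v∉X = clique⇒CliqueComponent , indep⇒TreeComponent
  where
  survivors : ∀ {K} → ∣ K ∣ ≡ k + 2 → ∃₂ λ a b → a ≢ b × (a ∈ K × a ∉ X) × (b ∈ K × b ∉ X)
  survivors {K} ∣K∣≡k+2 = two-∈p∧∉q K X (begin
    2 + ∣ X ∣  ≤⟨ s≤s (s≤s ∣X∣≤k) ⟩
    2 + k      ≡⟨ +-comm 2 k ⟩
    k + 2      ≡⟨ sym ∣K∣≡k+2 ⟩
    ∣ K ∣      ∎)
    where open ≤-Reasoning

  clique⇒CliqueComponent : NbhdHasClique G v (k + 2) → CliqueComponent G X v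
  clique⇒CliqueComponent (K , ∣K∣≡k+2 , K⊆N[v] , K-clique)
    with survivors ∣K∣≡k+2 | feasible v v∉X
  ... | _ | inj₁ clique = clique
  ... | a , b , a≢b , (a∈K , a∉X) , (b∈K , b∉X) | inj₂ tree =
    ⊥-elim (adjacent-neighbours⇒¬TreeComponent G v∉X a∉X b∉X (K⊆N[v] a a∈K) (K⊆N[v] b b∈K)
              (proj₁ (K-clique a b a∈K b∈K a≢b)) tree)

  indep⇒TreeComponent : NbhdHasIndep G v (k + 2) → TreeComponent G X v
  indep⇒TreeComponent (K , ∣K∣≡k+2 , K⊆N[v] , K-indep)
    with survivors ∣K∣≡k+2 | feasible v v∉X
  ... | _ | inj₂ tree = tree
  ... | a , b , a≢b , (a∈K , a∉X) , (b∈K , b∉X) | inj₁ clique =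
    ⊥-elim (nonadjacent-neighbours⇒¬CliqueComponent G v∉X a∉X b∉X a≢b (K⊆N[v] a a∈K) (K⊆N[v] b b∈K)
              (K-indep a b a∈K b∈K) clique)
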